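{- Let $(X,\mathcal{B})$ be a tree-like ball space. Then (1) $\operatorname{cir}(\mathcal{B})\le 1$; (2) $(X,\operatorname{ci}(\mathcal{B}))$ is tree-like; (3) $(X,\operatorname{ci}(\mathcal{B}))$ is spherically complete whenever $(X,\mathcal{B})$ is.
   Context: A ball space $(X,\mathcal{B})$ is a nonempty set $X$ with a nonempty collection $\mathcal{B}$ of nonempty subsets of $X$. A chain in $\mathcal{B}$ is a nonempty subset linearly ordered by inclusion; $(X,\mathcal{B})$ is spherically complete if every chain has nonempty intersection. For a nonempty family $\mathcal{B}$ of nonempty sets, $\operatorname{ci}(\mathcal{B})$ is the family of all nonempty sets $\bigcap\mathcal{C}$ with $\mathcal{C}\subseteq\mathcal{B}$ a chain. Define by transfinite recursion $\operatorname{ci}_0(\mathcal{B})=\mathcal{B}$ and $\operatorname{ci}_\alpha(\mathcal{B})=\operatorname{ci}\big(\bigcup_{\xi<\alpha}\operatorname{ci}_\xi(\mathcal{B})\big)$ for $\alpha>0$; the chain intersection rank $\operatorname{cir}(\mathcal{B})$ is the least ordinal $\alpha$ with $\operatorname{ci}_{\alpha+1}(\mathcal{B})=\operatorname{ci}_\alpha(\mathcal{B})$. $(X,\mathcal{B})$ is tree-like if for all $B_1,B_2\in\mathcal{B}$, $B_1\cap B_2\ne\emptyset$ implies $B_1\subseteq B_2$ or $B_2\subseteq B_1$. -}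

module Defs where

open import Level using (Level; Lift; lift; lower; _⊔_) renaming (suc to lsuc; zero to lzero)
open import Data.Nat using (ℕ; zero; suc)
open import Data.Product using (Σ; ∃; _×_; _,_; proj₁; proj₂)
open import Data.Sum using (_⊎_; inj₁; inj₂)

-- A family of subsets of X, indexed by a type Idx (the same subset may
-- occur under several indices; this is harmless for all notions below).
record Fam {x : Level} (X : Set x) (a : Level) : Set (lsuc a ⊔ x) where
  constructor fam
  field
    Idx  : Set a
    ball : Idx → X → Set a
open Fam public

module _ {x : Level} {X : Set x} where

  _⊆ₛ_ : {a b : Level} → (X → Set a) → (X → Set b) → Set (x ⊔ a ⊔ b)
  S ⊆ₛ T = ∀ y → S y → T y

  _≐_ : {a b : Level} → (X → Set a) → (X → Set b) → Set (x ⊔ a ⊔ b)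
  S ≐ T = (S ⊆ₛ T) × (T ⊆ₛ S)

  NonEmptySet : {a : Level} → (X → Set a) → Set (x ⊔ a)
  NonEmptySet S = Σ X S

  IsBallSpace : {a : Level} → Fam X a → Set (x ⊔ a)
  IsBallSpace B = Idx B × (∀ i → NonEmptySet (ball B i))

  IsChain : {a : Level} (B : Fam X a) → (Idx B → Set a) → Set (x ⊔ a)
  IsChain B C = Σ (Idx B) C
              × (∀ i j → C i → C j → (ball B i ⊆ₛ ball B j) ⊎ (ball B j ⊆ₛ ball B i))

  ⋂ : {a : Level} (B : Fam X a) → (Idx B → Set a) → X → Set a
  ⋂ B C y = ∀ i → C i → ball B i y

  SphericallyComplete : {a : Level} → Fam X a → Set (x ⊔ lsuc a)
  SphericallyComplete B = ∀ (C : Idx B → Set _) → IsChain B C → NonEmptySet (⋂ B C)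

  TreeLike : {a : Level} → Fam X a → Set (x ⊔ a)
  TreeLike B = ∀ i j → Σ X (λ y → ball B i y × ball B j y)
             → (ball B i ⊆ₛ ball B j) ⊎ (ball B j ⊆ₛ ball B i)

  ci : {a : Level} → Fam X a → Fam X (x ⊔ lsuc a)
  Idx  (ci B) = Σ (Idx B → Set _) (λ C → IsChain B C × NonEmptySet (⋂ B C))
  ball (ci B) (C , _) y = Lift _ (⋂ B C y)

  liftFam : {a : Level} (b : Level) → Fam X a → Fam X (a ⊔ b)
  Idx  (liftFam b B) = Lift b (Idx B)
  ball (liftFam b B) (lift i) y = Lift b (ball B i y)

  _∪_ : {a : Level} → Fam X a → Fam X a → Fam X a
  Idx  (B ∪ D) = Idx B ⊎ Idx D
  ball (B ∪ D) (inj₁ i) = ball B i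
  ball (B ∪ D) (inj₂ j) = ball D j

  _≈F_ : {a b : Level} → Fam X a → Fam X b → Set (x ⊔ a ⊔ b)
  B ≈F D = (∀ i → Σ (Idx D) (λ j → ball B i ≐ ball D j))
         × (∀ j → Σ (Idx B) (λ i → ball B i ≐ ball D j))

  -- finite stages of the transfinite recursion:
  -- lv n is the universe level of the n-th stage.
  lv : Level → ℕ → Level
  lv a zero    = a
  lv a (suc n) = x ⊔ lsuc (lv a n)

  -- U B n = ⋃_{ξ ≤ n} ci_ξ(B)
  U : {a : Level} → Fam X a → (n : ℕ) → Fam X (lv a n)
  ciₙ : {a : Level} → Fam X a → (n : ℕ) → Fam X (lv a n)

  ciₙ B zero    = B
  ciₙ B (suc n) = ci (U B n)

  U B zero    = B
  U {a} B (suc n) = liftFam (x ⊔ lsuc (lv a n)) (U B n) ∪ ciₙ B (suc n)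

  -- cir(B) ≤ 1 : the least α with ci_{α+1}(B) = ci_α(B) is 0 or 1
  cir≤1 : {a : Level} → Fam X a → Set _
  cir≤1 B = (ciₙ B 1 ≈F ciₙ B 0) ⊎ (ciₙ B 2 ≈F ciₙ B 1)

-- In a tree-like ball space, balls with a common point form a chain. Hence a
-- chain of chain intersections, or of balls and chain intersections, can be
-- replaced by the union of the chains generating its members: the balls of
-- this union pairwise meet, so it is again a chain in B, with the same
-- intersection. This gives cir(B) ≤ 1 and transfers spherical completeness
-- to ci(B). Two chain intersections ⋂C, ⋂D that meet are comparable: either
-- every ball of D contains a ball of C, or some ball of D contains none and,
-- being comparable with each of them, lies inside all of them.
module Submission where

open import Defs
open import Level using (Level; Lift; lift; lower) renaming (zero to lzero)
open import Data.Product using (_×_; Σ; _,_; proj₁; proj₂)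
open import Data.Sum using (_⊎_; inj₁; inj₂)
open import Data.Empty using (⊥-elim)
open import Relation.Nullary using (yes; no; ¬_)
open import Relation.Nullary.Decidable using (True; toWitness; fromWitness; decidable-stable)
open import Relation.Binary.PropositionalEquality using (_≡_; refl)
open import Axiom.ExcludedMiddle using (ExcludedMiddle)

module _ {x : Level} {X : Set x} where

  pairwiseMeeting⇒chain : ∀ {a} (B : Fam X a) → TreeLike B → (C : Idx B → Set a)
    → Σ (Idx B) C → (∀ i j → C i → C j → Σ X λ y → ball B i y × ball B j y)
    → IsChain B C
  pairwiseMeeting⇒chain B tl C ne meet = ne , λ i j Ci Cj → tl i j (meet i j Ci Cj)

  ball⇒ci-ball : ∀ {a} (B : Fam X a) j → NonEmptySet (ball B j)
    → Σ (Idx (ci B)) λ I → ball (ci B) I ≐ ball B j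
  ball⇒ci-ball B j (y , yj) =
    ((_≡ j) , ((j , refl) , λ { _ _ refl refl → inj₁ λ _ p → p }) , (y , λ { _ refl → yj })) ,
    (λ z p → lower p j refl) ,
    (λ z q → lift λ { _ refl → q })

  ci-ball-nonempty : ∀ {a} (B : Fam X a) J → NonEmptySet (ball (ci B) J)
  ci-ball-nonempty B (_ , _ , (y , y∈J)) = y , lift y∈J

module Classical (em : {ℓ : Level} → ExcludedMiddle ℓ) where

  -- Excluded middle lets every proposition be replaced by an equivalent one
  -- in Set; this keeps chains built from chains of larger level inside B.
  Resized : ∀ {ℓ} → Set ℓ → Set
  Resized P = True (em {P = P})

  resize : ∀ {ℓ} {P : Set ℓ} → P → Resized P
  resize p = fromWitness p

  unresize : ∀ {ℓ} {P : Set ℓ} → Resized P → P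
  unresize r = toWitness r

  ∀⊎∃¬ : ∀ {a p} {A : Set a} (P : A → Set p) → (∀ a → P a) ⊎ Σ A (λ a → ¬ P a)
  ∀⊎∃¬ P with em {P = Σ _ λ a → ¬ P a}
  ... | yes counterexample = inj₂ counterexample
  ... | no ¬counterexample = inj₁ λ a → decidable-stable em λ ¬Pa → ¬counterexample (a , ¬Pa)

  module _ {x : Level} {X : Set x} (B : Fam X lzero) (tl : TreeLike B) where

    ci-treeLike : TreeLike (ci B)
    ci-treeLike (C , _) (D , _) (y , lift yC , lift yD)
      with ∀⊎∃¬ {A = Σ (Idx B) D} (λ d → Σ (Idx B) λ c → C c × (ball B c ⊆ₛ ball B (proj₁ d)))
    ... | inj₁ refines = inj₁ λ z z∈C → lift λ d Dd →
            let (c , Cc , c⊆d) = refines (d , Dd) in c⊆d z (lower z∈C c Cc)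
    ... | inj₂ ((d , Dd) , noneBelow) = inj₂ λ z z∈D → lift λ c Cc →
            d⊆C c Cc z (lower z∈D d Dd)
      where
      d⊆C : ∀ c → C c → ball B d ⊆ₛ ball B c
      d⊆C c Cc with tl c d (y , yC c Cc , yD d Dd)
      ... | inj₁ c⊆d = ⊥-elim (noneBelow (c , Cc , c⊆d))
      ... | inj₂ d⊆c = d⊆c

    module Generated {d : Level} (D : Fam X d) (gen : Idx D → Idx B → Set)
      (gen-nonempty : ∀ m → Σ (Idx B) (gen m))
      (ball≐⋂gen : ∀ m → ball D m ≐ ⋂ B (gen m)) where

      ⋃gen : (Idx D → Set d) → Idx B → Set
      ⋃gen 𝒞 i = Resized (Σ (Idx D) λ m → 𝒞 m × gen m i)

      ⋃gen-nonempty : ∀ 𝒞 → Σ (Idx D) 𝒞 → Σ (Idx B) (⋃gen 𝒞)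
      ⋃gen-nonempty 𝒞 (m , 𝒞m) = let (i , gen-m-i) = gen-nonempty m in
        i , resize (m , 𝒞m , gen-m-i)

      ⋂≐⋂⋃gen : ∀ 𝒞 → ⋂ D 𝒞 ≐ ⋂ B (⋃gen 𝒞)
      ⋂≐⋂⋃gen 𝒞 =
        (λ z z∈𝒞 i i∈⋃ → let (m , 𝒞m , gen-m-i) = unresize i∈⋃ in
          proj₁ (ball≐⋂gen m) z (z∈𝒞 m 𝒞m) i gen-m-i) ,
        (λ z z∈⋃ m 𝒞m → proj₂ (ball≐⋂gen m) z λ i gen-m-i → z∈⋃ i (resize (m , 𝒞m , gen-m-i)))

      ci-flatten : ∀ I → Σ (Idx (ci B)) λ J → ball (ci D) I ≐ ball (ci B) J
      ci-flatten (𝒞 , (ne , _) , (y , y∈𝒞)) =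
        (⋃gen 𝒞 , chain , (y , y∈⋃)) ,
        (λ z p → lift (proj₁ (⋂≐⋂⋃gen 𝒞) z (lower p))) ,
        (λ z q → lift (proj₂ (⋂≐⋂⋃gen 𝒞) z (lower q)))
        where
        y∈⋃ : ⋂ B (⋃gen 𝒞) y
        y∈⋃ = proj₁ (⋂≐⋂⋃gen 𝒞) y y∈𝒞
        chain : IsChain B (⋃gen 𝒞)
        chain = pairwiseMeeting⇒chain B tl (⋃gen 𝒞) (⋃gen-nonempty 𝒞 ne)
          λ i j ⋃i ⋃j → y , y∈⋃ i ⋃i , y∈⋃ j ⋃j

    ci-generated : ∀ c → ball (ci B) c ≐ ⋂ B (proj₁ c)
    ci-generated c = (λ _ p → lower p) , (λ _ q → lift q)

    ci-gen-nonempty : ∀ (c : Idx (ci B)) → Σ (Idx B) (proj₁ c)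
    ci-gen-nonempty (_ , ((i , Ci) , _) , _) = i , Ci

    ci-sphericallyComplete : SphericallyComplete B → SphericallyComplete (ci B)
    ci-sphericallyComplete sc 𝒞 (ne , comparable) =
      let (z , z∈⋃) = sc (⋃gen 𝒞) (pairwiseMeeting⇒chain B tl (⋃gen 𝒞) (⋃gen-nonempty 𝒞 ne) meet)
      in z , proj₂ (⋂≐⋂⋃gen 𝒞) z z∈⋃
      where
      open Generated (ci B) proj₁ ci-gen-nonempty ci-generated
      meet : ∀ i j → ⋃gen 𝒞 i → ⋃gen 𝒞 j → Σ X λ y → ball B i y × ball B j y
      meet i j ⋃i ⋃j with unresize ⋃i | unresize ⋃j
      ... | (c , 𝒞c , Ci) | (d , 𝒞d , Dj) with comparable c d 𝒞c 𝒞d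
      ... | inj₁ c⊆d = let (y , y∈c) = ci-ball-nonempty B c in
            y , lower y∈c i Ci , lower (c⊆d y y∈c) j Dj
      ... | inj₂ d⊆c = let (y , y∈d) = ci-ball-nonempty B d in
            y , lower (d⊆c y y∈d) i Ci , lower y∈d j Dj

    U₁-gen : Idx (U B 1) → Idx B → Set
    U₁-gen (inj₁ (lift k)) i = k ≡ i
    U₁-gen (inj₂ c) = proj₁ c

    U₁-gen-nonempty : ∀ m → Σ (Idx B) (U₁-gen m)
    U₁-gen-nonempty (inj₁ (lift k)) = k , refl
    U₁-gen-nonempty (inj₂ c) = ci-gen-nonempty c

    U₁-generated : ∀ m → ball (U B 1) m ≐ ⋂ B (U₁-gen m)
    U₁-generated (inj₁ (lift k)) = (λ _ p → λ { _ refl → lower p }) , (λ _ q → lift (q k refl))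
    U₁-generated (inj₂ c) = ci-generated c

    cir≤1-treeLike : cir≤1 B
    cir≤1-treeLike = inj₂ (ci-flatten , λ J → ball⇒ci-ball (U B 1) (inj₂ J) (ci-ball-nonempty B J))
      where open Generated (U B 1) U₁-gen U₁-gen-nonempty U₁-generated

theorem2p2 : (em : {ℓ : Level} → ExcludedMiddle ℓ)
    → (X : Set) (B : Fam X Level.zero)
    → IsBallSpace B → TreeLike B
    → cir≤1 B × TreeLike (ci B) × (SphericallyComplete B → SphericallyComplete (ci B))
theorem2p2 em X B _ tl = cir≤1-treeLike B tl , ci-treeLike B tl , ci-sphericallyComplete B tl
  where open Classical em
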